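{- For any integer $\ell\ge1$ and any graph $G$, $\chi_\ell(G)\le(\ell+1)\operatorname{pw}(G)+1$.
   Context: $\operatorname{pw}(G)$ is the pathwidth of $G$: the minimum width ($\max$ bag size minus one) of a tree decomposition of $G$ whose underlying tree is a path (or disjoint union of paths). A colouring $\varphi:V(G)\to\mathbb{N}$ is an $\ell$-ranking if for every non-trivial path $u_0,\ldots,u_p$ in $G$ of length $p\le \ell$, either $\varphi(u_0)\neq\varphi(u_p)$ or $\varphi(u_0)<\max\{\varphi(u_0),\ldots,\varphi(u_p)\}$; $\chi_\ell(G)$ is the minimum $k$ such that $G$ has an $\ell$-ranking with colours in $\{1,\ldots,k\}$. -}

module Defs where

open import Data.Nat using (ℕ; zero; suc; _+_; _*_; _≤_; _<_; _⊔_)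
open import Data.Fin using (Fin; fromℕ; inject₁) renaming (_≤_ to _≤ᶠ_) renaming (zero to fzero; suc to fsuc)
open import Data.Fin.Subset using (Subset; _∈_; ∣_∣)
open import Data.Product using (Σ; ∃; _×_)
open import Data.Sum using (_⊎_)
open import Relation.Nullary using (¬_)
open import Relation.Binary.PropositionalEquality using (_≡_; _≢_)
open import Function.Definitions using (Injective)
open import Level using (0ℓ)

record Graph : Set₁ where
  field
    n      : ℕ
    Adj    : Fin n → Fin n → Set
    sym    : ∀ {u v} → Adj u v → Adj v u
    irrefl : ∀ {v} → ¬ Adj v v
open Graph public

record PathDecomposition (G : Graph) : Set where
  field
    m       : ℕ
    bag     : Fin m → Subset (n G)
    covers  : ∀ v → ∃ λ i → v ∈ bag i
    edges   : ∀ u v → Adj G u v → ∃ λ i → (u ∈ bag i) × (v ∈ bag i)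
    interval : ∀ v (i j k : Fin m) → i ≤ᶠ j → j ≤ᶠ k →
               v ∈ bag i → v ∈ bag k → v ∈ bag j
open PathDecomposition public

HasWidthAtMost : {G : Graph} → PathDecomposition G → ℕ → Set
HasWidthAtMost D w = ∀ i → ∣ bag D i ∣ ≤ suc w

PathwidthAtMost : Graph → ℕ → Set
PathwidthAtMost G w = Σ (PathDecomposition G) λ D → HasWidthAtMost D w

record GPath (G : Graph) (p : ℕ) : Set where
  field
    vtx      : Fin (suc p) → Fin (n G)
    distinct : Injective _≡_ _≡_ vtx
    adjacent : ∀ (i : Fin p) → Adj G (vtx (inject₁ i)) (vtx (fsuc i))
open GPath public

maxF : ∀ m → (Fin m → ℕ) → ℕ
maxF zero    f = 0
maxF (suc m) f = f fzero ⊔ maxF m (λ i → f (fsuc i))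

IsRanking : (ℓ : ℕ) (G : Graph) → (Fin (n G) → ℕ) → Set
IsRanking ℓ G φ =
  ∀ (p : ℕ) → 1 ≤ p → p ≤ ℓ → (P : GPath G p) →
    (φ (vtx P fzero) ≢ φ (vtx P (fromℕ p)))
    ⊎ (φ (vtx P fzero) < maxF (suc p) (λ i → φ (vtx P i)))

HasRankingWith : (ℓ : ℕ) (G : Graph) (k : ℕ) → Set
HasRankingWith ℓ G k =
  Σ (Fin (n G) → ℕ) λ φ → (∀ v → (1 ≤ φ v) × (φ v ≤ k)) × IsRanking ℓ G φ

module Submission where

-- Fix a path decomposition.  By induction on w, every vertex set S meeting each bag in at
-- most w+1 vertices has a colouring with (ℓ+1)w+1 colours satisfying the ℓ-ranking
-- condition on paths inside S (rankingOn).  For w = 0, S spans no edge.  For the step,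
-- scan the bags left to right keeping a current vertex of S: it is kept while it lies in
-- the bag, otherwise the scan moves to the vertex of the bag in S living longest, and
-- counts the move.  The selected vertices X meet every bag meeting S, so S ∖ X is coloured
-- by induction; selected vertices get fresh colours base + 1 + (move count mod ℓ+1).
-- Along an edge inside S the count changes by at most one (lifetime-moves), so selected
-- ends of a path of length p ≤ ℓ with congruent counts have equal counts, hence are equal.

open import Defs hiding (sym)
open import Data.Nat using (ℕ; zero; suc; _+_; _*_; _≤_; _<_; _∸_; _⊔_; z≤n; s≤s; z<s;
  _≤′_; ≤′-refl; ≤′-step; _<?_; _≤?_; _%_; _/_; NonZero)
open import Data.Nat.Properties
open import Data.Nat.DivMod using (m≡m%n+[m/n]*n; m%n<n; /-monoˡ-≤)
open import Data.Nat.Solver using (module +-*-Solver)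
open import Data.Fin using (Fin; fromℕ; fromℕ<; inject₁; toℕ)
  renaming (zero to fzero; suc to fsuc; _≤_ to _≤ᶠ_; _≟_ to _≟ᶠ_)
open import Data.Fin.Properties using (toℕ-fromℕ<; fromℕ<-toℕ; toℕ-injective; toℕ-inject₁;
  toℕ-fromℕ; toℕ<n; any?)
open import Data.Fin.Subset using (Subset; _∈_; _∉_; ∣_∣; _∩_; _─_; _-_; _⊆_; ⊤; Nonempty)
open import Data.Fin.Subset.Properties using (_∈?_; nonempty?; x∈p∩q⁺; x∈p∩q⁻; p─q⊆p;
  Empty-unique; ∣⊥∣≡0; p⊆q⇒∣p∣≤∣q∣; p∩q≢∅⇒∣p─q∣<∣p∣; x∈p∧x∉q⇒x∈p─q; x∈p∧x≢y⇒x∈p-y;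
  x∈p⇒∣p-x∣<∣p∣; x∈⁅y⁆⇒x≡y; ∣⁅x⁆∣≡1; ∈⊤; ∣p∩q∣≤∣p∣)
open import Data.Vec using (_∷_; there; tabulate)
open import Data.Vec.Properties using (lookup∘tabulate; lookup⇒[]=; []=⇒lookup)
open import Data.Maybe using (Maybe; just; nothing)
open import Data.Maybe.Properties using (just-injective; ≡-dec)
open import Data.Maybe.Relation.Unary.All using (All; just; nothing)
open import Data.Product using (Σ; _×_; _,_; proj₁; proj₂)
open import Data.Sum using (_⊎_; inj₁; inj₂)
open import Data.Empty using (⊥; ⊥-elim)
open import Relation.Nullary using (¬_; Dec; yes; no; does)
open import Relation.Nullary.Decidable using (dec-true; toSum)
open import Relation.Binary.PropositionalEquality
  using (_≡_; _≢_; refl; sym; trans; cong; cong₂; subst; subst₂; module ≡-Reasoning)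

argmax : ∀ {k} (P : Fin k → Set) → (∀ x → Dec (P x)) → (key : Fin k → ℕ) →
         (∀ y → ¬ P y) ⊎ (Σ (Fin k) λ x → P x × (∀ y → P y → key y ≤ key x))
argmax {zero} P P? key = inj₁ λ ()
argmax {suc k} P P? key
  with argmax (λ x → P (fsuc x)) (λ x → P? (fsuc x)) (λ x → key (fsuc x)) | P? fzero
... | inj₁ none | no ¬p₀ = inj₁ λ { fzero p → ¬p₀ p ; (fsuc y) p → none y p }
... | inj₁ none | yes p₀ =
  inj₂ (fzero , p₀ , λ { fzero _ → ≤-refl ; (fsuc y) p → ⊥-elim (none y p) })
... | inj₂ (x , px , max) | no ¬p₀ =
  inj₂ (fsuc x , px , λ { fzero p → ⊥-elim (¬p₀ p) ; (fsuc y) p → max y p })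
... | inj₂ (x , px , max) | yes p₀ with key fzero ≤? key (fsuc x)
...   | yes k₀≤ = inj₂ (fsuc x , px , λ { fzero _ → k₀≤ ; (fsuc y) p → max y p })
...   | no k₀≰ = inj₂ (fzero , p₀ , λ { fzero _ → ≤-refl
                                     ; (fsuc y) p → ≤-trans (max y p) (<⇒≤ (≰⇒> k₀≰)) })

maxF-ub : ∀ m (f : Fin m → ℕ) (k : Fin m) → f k ≤ maxF m f
maxF-ub (suc m) f fzero = m≤m⊔n _ _
maxF-ub (suc m) f (fsuc k) = ≤-trans (maxF-ub m (λ i → f (fsuc i)) k) (m≤n⊔m _ _)

maxF-cong : ∀ m (f g : Fin m → ℕ) → (∀ k → f k ≡ g k) → maxF m f ≡ maxF m g
maxF-cong zero f g f≗g = refl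
maxF-cong (suc m) f g f≗g =
  cong₂ _⊔_ (f≗g fzero) (maxF-cong m (λ i → f (fsuc i)) (λ i → g (fsuc i)) (λ k → f≗g (fsuc k)))

-- Two numbers at distance less than d with the same residue modulo d are equal:
-- a larger quotient would put b at least d above a.
residue-window : ∀ a b d .{{_ : NonZero d}} → a % d ≡ b % d → a ≤ b → b < a + d → a ≡ b
residue-window a b d same a≤b b<a+d with m≤n⇒m<n∨m≡n (/-monoˡ-≤ d a≤b)
... | inj₂ q≡ = begin
  a                  ≡⟨ m≡m%n+[m/n]*n a d ⟩
  a % d + a / d * d  ≡⟨ cong₂ (λ r q → r + q * d) same q≡ ⟩
  b % d + b / d * d  ≡⟨ sym (m≡m%n+[m/n]*n b d) ⟩
  b                  ∎
  where open ≡-Reasoning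
... | inj₁ q< = ⊥-elim (<⇒≱ b<a+d a+d≤b)
  where
  open ≤-Reasoning
  a+d≤b : a + d ≤ b
  a+d≤b = begin
    a + d                    ≡⟨ cong (_+ d) (m≡m%n+[m/n]*n a d) ⟩
    a % d + a / d * d + d    ≡⟨ +-assoc (a % d) _ d ⟩
    a % d + (a / d * d + d)  ≡⟨ cong (a % d +_) (+-comm _ d) ⟩
    a % d + suc (a / d) * d  ≤⟨ +-mono-≤ (≤-reflexive same) (*-monoˡ-≤ d q<) ⟩
    b % d + b / d * d        ≡⟨ sym (m≡m%n+[m/n]*n b d) ⟩
    b                        ∎

residue-close : ∀ a b d p .{{_ : NonZero d}} → a % d ≡ b % d →
                b ≤ a + p → a ≤ b + p → p < d → a ≡ b
residue-close a b d p same b≤a+p a≤b+p p<d with ≤-total a b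
... | inj₁ a≤b = residue-window a b d same a≤b (≤-<-trans b≤a+p (+-monoʳ-< a p<d))
... | inj₂ b≤a = sym (residue-window b a d (sym same) b≤a (≤-<-trans a≤b+p (+-monoʳ-< b p<d)))

∈─⇒∉ : ∀ {N} (p q : Subset N) {x} → x ∈ p ─ q → x ∉ q
∈─⇒∉ (_ ∷ p) (_ ∷ q) (there x∈p─q) (there x∈q) = ∈─⇒∉ p q x∈p─q x∈q

distinct-members : ∀ {N} (q : Subset N) {u v} → u ∈ q → v ∈ q → u ≢ v → 2 ≤ ∣ q ∣
distinct-members q {u} {v} u∈q v∈q u≢v =
  ≤-trans (s≤s one-left) (x∈p⇒∣p-x∣<∣p∣ u∈q)
  where
  v∈q-u : v ∈ q - u
  v∈q-u = x∈p∧x≢y⇒x∈p-y v∈q (λ v≡u → u≢v (sym v≡u))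
  one-left : 1 ≤ ∣ q - u ∣
  one-left = subst (_≤ ∣ q - u ∣) (∣⁅x⁆∣≡1 v)
               (p⊆q⇒∣p∣≤∣q∣ λ z∈⁅v⁆ → subst (_∈ q - u) (sym (x∈⁅y⁆⇒x≡y v z∈⁅v⁆)) v∈q-u)

-- If X meets B ∩ S as soon as B ∩ S is nonempty, removing X from S loses a vertex of B;
-- this is how the selected vertices lower the width.
remove-hitting-set : ∀ {N k} (B S X : Subset N) →
                     (∀ {y} → y ∈ B ∩ S → Nonempty ((B ∩ S) ∩ X)) →
                     ∣ B ∩ S ∣ ≤ suc k → ∣ B ∩ (S ─ X) ∣ ≤ k
remove-hitting-set {N} {k} B S X hits size with nonempty? (B ∩ S)
... | yes (y , y∈B∩S) = ≤-pred (begin-strict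
  ∣ B ∩ (S ─ X) ∣  ≤⟨ p⊆q⇒∣p∣≤∣q∣ inside ⟩
  ∣ (B ∩ S) ─ X ∣  <⟨ p∩q≢∅⇒∣p─q∣<∣p∣ (B ∩ S) X (hits y∈B∩S) ⟩
  ∣ B ∩ S ∣        ≤⟨ size ⟩
  suc k            ∎)
  where
  open ≤-Reasoning
  inside : B ∩ (S ─ X) ⊆ (B ∩ S) ─ X
  inside z∈ with x∈p∩q⁻ B (S ─ X) z∈
  ... | z∈B , z∈S─X = x∈p∧x∉q⇒x∈p─q (x∈p∩q⁺ (z∈B , p─q⊆p S X z∈S─X)) (∈─⇒∉ S X z∈S─X)
... | no empty = begin
  ∣ B ∩ (S ─ X) ∣  ≤⟨ p⊆q⇒∣p∣≤∣q∣ inside ⟩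
  ∣ B ∩ S ∣        ≡⟨ trans (cong ∣_∣ (Empty-unique empty)) (∣⊥∣≡0 N) ⟩
  0                ≤⟨ z≤n ⟩
  k                ∎
  where
  open ≤-Reasoning
  inside : B ∩ (S ─ X) ⊆ B ∩ S
  inside z∈ with x∈p∩q⁻ B (S ─ X) z∈
  ... | z∈B , z∈S─X = x∈p∩q⁺ (z∈B , p─q⊆p S X z∈S─X)

IsWalk : (G : Graph) → (ℕ → Fin (n G)) → ℕ → Set
IsWalk G f p = ∀ k → k < p → Adj G (f k) (f (suc k))

reverse-walk : ∀ {G} f p → IsWalk G f p → IsWalk G (λ k → f (p ∸ k)) p
reverse-walk {G} f p walk k k<p =
  subst (λ j → Adj G (f j) (f (p ∸ suc k))) (sym p∸k≡)
    (Graph.sym G (walk (p ∸ suc k) (subst (_≤ p) p∸k≡ (m∸n≤m p k))))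
  where
  p∸k≡ : p ∸ k ≡ suc (p ∸ suc k)
  p∸k≡ = +-∸-assoc 1 k<p

-- Position k of a path of length p as an index; positions beyond p are sent to 0.
position : ∀ p → ℕ → Fin (suc p)
position p k with k ≤? p
... | yes k≤p = fromℕ< (s≤s k≤p)
... | no _ = fzero

toℕ-position : ∀ {p k} → k ≤ p → toℕ (position p k) ≡ k
toℕ-position {p} {k} k≤p with k ≤? p
... | yes _ = toℕ-fromℕ< _
... | no k≰p = ⊥-elim (k≰p k≤p)

-- A path read as an ℕ-indexed walk, so that its length can be treated by induction.
module _ {G : Graph} {p : ℕ} (P : GPath G p) where
  walkOf : ℕ → Fin (n G)
  walkOf k = vtx P (position p k)

  walkOf-start : walkOf 0 ≡ vtx P fzero
  walkOf-start = cong (vtx P) (toℕ-injective (toℕ-position {p} {0} z≤n))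

  walkOf-end : walkOf p ≡ vtx P (fromℕ p)
  walkOf-end = cong (vtx P) (toℕ-injective (trans (toℕ-position ≤-refl) (sym (toℕ-fromℕ p))))

  walkOf-isWalk : IsWalk G walkOf p
  walkOf-isWalk k k<p =
    subst₂ (λ a b → Adj G (vtx P a) (vtx P b)) (sym at-k) (sym at-suc-k) (adjacent P (fromℕ< k<p))
    where
    at-k : position p k ≡ inject₁ (fromℕ< k<p)
    at-k = toℕ-injective (trans (toℕ-position (<⇒≤ k<p))
                                (sym (trans (toℕ-inject₁ _) (toℕ-fromℕ< k<p))))
    at-suc-k : position p (suc k) ≡ fsuc (fromℕ< k<p)
    at-suc-k = toℕ-injective (trans (toℕ-position k<p) (cong suc (sym (toℕ-fromℕ< k<p))))

  path-ends-distinct : 1 ≤ p → vtx P fzero ≢ vtx P (fromℕ p)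
  path-ends-distinct 1≤p ends≡ = <-irrefl (trans (cong toℕ (distinct P ends≡)) (toℕ-fromℕ p)) 1≤p

RankedPath : ∀ {G p} → (Fin (n G) → ℕ) → GPath G p → Set
RankedPath {p = p} φ P =
  (φ (vtx P fzero) ≢ φ (vtx P (fromℕ p))) ⊎ (φ (vtx P fzero) < maxF (suc p) (λ i → φ (vtx P i)))

RankingOn : (ℓ : ℕ) (G : Graph) → Subset (n G) → (Fin (n G) → ℕ) → Set
RankingOn ℓ G S φ =
  ∀ (p : ℕ) → 1 ≤ p → p ≤ ℓ → (P : GPath G p) → (∀ k → vtx P k ∈ S) → RankedPath φ P

ColoursIn : ∀ {G : Graph} → ℕ → (Fin (n G) → ℕ) → Set
ColoursIn {G} k φ = ∀ (v : Fin (n G)) → (1 ≤ φ v) × (φ v ≤ k)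

ranking-transfer : ∀ {G p} (P : GPath G p) (φ ψ : Fin (n G) → ℕ) →
                   (∀ k → φ (vtx P k) ≡ ψ (vtx P k)) → RankedPath φ P → RankedPath ψ P
ranking-transfer {p = p} P φ ψ φ≗ψ (inj₁ differ) =
  inj₁ λ same → differ (trans (φ≗ψ fzero) (trans same (sym (φ≗ψ (fromℕ p)))))
ranking-transfer {p = p} P φ ψ φ≗ψ (inj₂ below) =
  inj₂ (subst₂ _<_ (φ≗ψ fzero) (maxF-cong (suc p) _ _ φ≗ψ) below)

module Ranking (G : Graph) (D : PathDecomposition G) where
  V : Set
  V = Fin (n G)

  M : ℕ
  M = m D

  -- v lies in the bag at position i (positions ≥ M hold no bag).
  InBag : V → ℕ → Set
  InBag v i = Σ (i < M) λ i<M → v ∈ bag D (fromℕ< i<M)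

  inBag? : ∀ v i → Dec (InBag v i)
  inBag? v i with i <? M
  ... | no i≮M = no λ (i<M , _) → i≮M i<M
  ... | yes i<M with v ∈? bag D (fromℕ< i<M)
  ...   | yes v∈ = yes (i<M , v∈)
  ...   | no v∉ = no λ (lt , v∈) →
    v∉ (subst (λ lt → v ∈ bag D (fromℕ< lt)) (<-irrelevant lt i<M) v∈)

  toInBag : ∀ {v} (b : Fin M) → v ∈ bag D b → InBag v (toℕ b)
  toInBag {v} b v∈ = toℕ<n b , subst (λ c → v ∈ bag D c) (sym (fromℕ<-toℕ b (toℕ<n b))) v∈

  fromInBag : ∀ {v} (b : Fin M) → InBag v (toℕ b) → v ∈ bag D b
  fromInBag {v} b (lt , v∈) = subst (λ c → v ∈ bag D c) (fromℕ<-toℕ b lt) v∈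

  inBag-convex : ∀ {v i j k} → i ≤ j → j ≤ k → InBag v i → InBag v k → InBag v j
  inBag-convex {v} {i} {j} {k} i≤j j≤k (i<M , v∈i) (k<M , v∈k) =
    j<M , interval D v (fromℕ< i<M) (fromℕ< j<M) (fromℕ< k<M)
            (as-Fin i<M j<M i≤j) (as-Fin j<M k<M j≤k) v∈i v∈k
    where
    j<M : j < M
    j<M = ≤-<-trans j≤k k<M
    as-Fin : ∀ {a b} (a<M : a < M) (b<M : b < M) → a ≤ b → fromℕ< a<M ≤ᶠ fromℕ< b<M
    as-Fin _ _ a≤b = subst₂ _≤_ (sym (toℕ-fromℕ< _)) (sym (toℕ-fromℕ< _)) a≤b

  edgeBag : ∀ {u v} → Adj G u v → Σ ℕ λ i → InBag u i × InBag v i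
  edgeBag {u} {v} uv with edges D u v uv
  ... | b , u∈ , v∈ = toℕ b , toInBag b u∈ , toInBag b v∈

  -- The last position below k whose bag contains v (0 if there is none).
  lastBelow : V → ℕ → ℕ
  lastBelow v zero = 0
  lastBelow v (suc k) with inBag? v k
  ... | yes _ = k
  ... | no _ = lastBelow v k

  lastBelow-spec : ∀ {v i} k → i < k → InBag v i → i ≤ lastBelow v k × InBag v (lastBelow v k)
  lastBelow-spec {v} {i} (suc k) i<sk v∈i with inBag? v k
  ... | yes v∈k = ≤-pred i<sk , v∈k
  ... | no v∉k with m≤n⇒m<n∨m≡n (≤-pred i<sk)
  ...   | inj₁ i<k = lastBelow-spec k i<k v∈i
  ...   | inj₂ refl = ⊥-elim (v∉k v∈i)

  last : V → ℕ
  last v = lastBelow v M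

  last-ub : ∀ {v i} → InBag v i → i ≤ last v
  last-ub v∈i = proj₁ (lastBelow-spec M (proj₁ v∈i) v∈i)

  inBag-until-last : ∀ {v i j} → InBag v i → i ≤ j → j ≤ last v → InBag v j
  inBag-until-last v∈i i≤j j≤last =
    inBag-convex i≤j j≤last v∈i (proj₂ (lastBelow-spec M (proj₁ v∈i) v∈i))

  module Scan (S : Subset (n G)) where

    Candidate : ℕ → V → Set
    Candidate i y = InBag y i × y ∈ S

    candidate? : ∀ i y → Dec (Candidate i y)
    candidate? i y with inBag? y i | y ∈? S
    ... | yes y∈i | yes y∈S = yes (y∈i , y∈S)
    ... | no y∉i | _ = no λ (y∈i , _) → y∉i y∈i
    ... | yes _ | no y∉S = no λ (_ , y∈S) → y∉S y∈S

    Alive : ℕ → Maybe V → Set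
    Alive i nothing = ⊥
    Alive i (just x) = InBag x i

    alive? : ∀ i c → Dec (Alive i c)
    alive? i nothing = no λ ()
    alive? i (just x) = inBag? x i

    -- A state is the current vertex together with the number of moves made so far.
    State : Set
    State = Maybe V × ℕ

    step : ℕ → State → State
    step i (c , t) with alive? i c
    ... | yes _ = c , t
    ... | no _ with argmax (Candidate i) (candidate? i) last
    ...   | inj₁ _ = c , t
    ...   | inj₂ (x , _) = just x , suc t

    data StepView (i : ℕ) (s s' : State) : Set where
      stay : s' ≡ s → StepView i s s'
      move : ∀ x → ¬ Alive i (proj₁ s) → Candidate i x → (∀ y → Candidate i y → last y ≤ last x) →
             s' ≡ (just x , suc (proj₂ s)) → StepView i s s'

    stepView : ∀ i s → StepView i s (step i s)
    stepView i (c , t) with alive? i c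
    ... | yes _ = stay refl
    ... | no dead with argmax (Candidate i) (candidate? i) last
    ...   | inj₁ _ = stay refl
    ...   | inj₂ (x , cand , longest) = move x dead cand longest refl

    step-alive : ∀ i s → Alive i (proj₁ s) → step i s ≡ s
    step-alive i (c , t) alive with alive? i c
    ... | yes _ = refl
    ... | no dead = ⊥-elim (dead alive)

    alive-after-step : ∀ i s {y} → Candidate i y → Alive i (proj₁ (step i s))
    alive-after-step i (c , t) cand with alive? i c
    ... | yes alive = alive
    ... | no _ with argmax (Candidate i) (candidate? i) last
    ...   | inj₁ none = ⊥-elim (none _ cand)
    ...   | inj₂ (x , (x∈i , _) , _) = x∈i

    step-in-S : ∀ i s → All (_∈ S) (proj₁ s) → All (_∈ S) (proj₁ (step i s))
    step-in-S i (c , t) inS with alive? i c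
    ... | yes _ = inS
    ... | no _ with argmax (Candidate i) (candidate? i) last
    ...   | inj₁ _ = inS
    ...   | inj₂ (x , (_ , x∈S) , _) = just x∈S

    -- run (suc i) is the state after processing bag i.
    run : ℕ → State
    run zero = nothing , 0
    run (suc k) = step k (run k)

    current : ℕ → Maybe V
    current k = proj₁ (run k)

    count : ℕ → ℕ
    count k = proj₂ (run k)

    current-in-S : ∀ k → All (_∈ S) (current k)
    current-in-S zero = nothing
    current-in-S (suc k) = step-in-S k (run k) (current-in-S k)

    -- The count never decreases, and equal counts mean equal states, since the state only
    -- changes together with the count.
    unchanged-or-counted⇒≤ : ∀ k k' → run k ≡ run k' ⊎ count k < count k' → count k ≤ count k'
    unchanged-or-counted⇒≤ _ _ (inj₁ same) = ≤-reflexive (cong proj₂ same)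
    unchanged-or-counted⇒≤ _ _ (inj₂ less) = <⇒≤ less

    count-grows : ∀ {k k'} → k ≤′ k' → run k ≡ run k' ⊎ count k < count k'
    count-grows ≤′-refl = inj₁ refl
    count-grows {k} (≤′-step {k''} k≤′k'') with count-grows k≤′k'' | stepView k'' (run k'')
    ... | inj₁ same | stay e = inj₁ (trans same (sym e))
    ... | inj₂ less | stay e = inj₂ (subst (count k <_) (cong proj₂ (sym e)) less)
    ... | earlier | move _ _ _ _ e =
      inj₂ (subst (count k <_) (cong proj₂ (sym e)) (s≤s (unchanged-or-counted⇒≤ k k'' earlier)))

    count-mono : ∀ {k k'} → k ≤ k' → count k ≤ count k'
    count-mono {k} {k'} k≤k' = unchanged-or-counted⇒≤ k k' (count-grows (≤⇒≤′ k≤k'))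

    count-determines-state : ∀ k k' → count k ≡ count k' → run k ≡ run k'
    count-determines-state k k' same with ≤-total k k'
    ... | inj₁ k≤k' with count-grows (≤⇒≤′ k≤k')
    ...   | inj₁ e = e
    ...   | inj₂ less = ⊥-elim (<-irrefl same less)
    count-determines-state k k' same | inj₂ k'≤k with count-grows (≤⇒≤′ k'≤k)
    ...   | inj₁ e = sym e
    ...   | inj₂ less = ⊥-elim (<-irrefl (sym same) less)

    persists : ∀ {x k j} → current (suc k) ≡ just x → InBag x k → k ≤ j → j ≤ last x →
               run (suc j) ≡ run (suc k)
    persists {x} {k} cur x∈k k≤j j≤last = go (≤⇒≤′ k≤j) j≤last
      where
      go : ∀ {j} → k ≤′ j → j ≤ last x → run (suc j) ≡ run (suc k)
      go ≤′-refl _ = refl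
      go {suc j} (≤′-step k≤′j) sj≤last = trans (step-alive (suc j) (run (suc j)) alive) earlier
        where
        earlier : run (suc j) ≡ run (suc k)
        earlier = go k≤′j (≤-trans (n≤1+n j) sj≤last)
        alive : Alive (suc j) (current (suc j))
        alive = subst (Alive (suc j)) (sym (trans (cong proj₁ earlier) cur))
                  (inBag-until-last x∈k (≤′⇒≤ (≤′-step k≤′j)) sj≤last)

    Selected : V → ℕ → Set
    Selected x s = InBag x s × current (suc s) ≡ just x

    bag-has-selected : ∀ {i y} → Candidate i y → Σ V λ x → Selected x i × x ∈ S
    bag-has-selected {i} cand with current (suc i) | alive-after-step i (run i) cand
                                 | current-in-S (suc i)
    ... | just x | x∈i | just x∈S = x , (x∈i , refl) , x∈S

    selected-count-max : ∀ {x s i} → Selected x s → InBag x i → count (suc i) ≤ count (suc s)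
    selected-count-max {s = s} {i} (x∈s , cur) x∈i with ≤-total i s
    ... | inj₁ i≤s = count-mono (s≤s i≤s)
    ... | inj₂ s≤i = ≤-reflexive (cong proj₂ (persists cur x∈s s≤i (last-ub x∈i)))

    selected-count-unique : ∀ {x s s'} → Selected x s → Selected x s' →
                            count (suc s) ≡ count (suc s')
    selected-count-unique sel sel' =
      ≤-antisym (selected-count-max sel' (proj₁ sel)) (selected-count-max sel (proj₁ sel'))

    -- During the lifetime of y ∈ S the scan moves at most once: its first move picks a
    -- vertex living at least as long as y, which then remains current.
    lifetime-moves : ∀ {y i j} → y ∈ S → InBag y i → InBag y j → i ≤ j →
                     count (suc j) ≤ suc (count (suc i))
    lifetime-moves {y} {i} {j} y∈S y∈i y∈j i≤j = bounded (invariant (≤⇒≤′ i≤j) ≤-refl)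
      where
      t₀ : ℕ
      t₀ = count (suc i)

      AtMostOneMove : State → Set
      AtMostOneMove s =
        proj₂ s ≡ t₀ ⊎ (proj₂ s ≡ suc t₀ × Σ V λ x → proj₁ s ≡ just x × last y ≤ last x)

      bounded : ∀ {s} → AtMostOneMove s → proj₂ s ≤ suc t₀
      bounded (inj₁ t≡) = ≤-trans (≤-reflexive t≡) (n≤1+n t₀)
      bounded (inj₂ (t≡ , _)) = ≤-reflexive t≡

      y∈ : ∀ {k} → i ≤ k → k ≤ j → InBag y k
      y∈ i≤k k≤j = inBag-convex i≤k k≤j y∈i y∈j

      invariant : ∀ {k} → i ≤′ k → k ≤ j → AtMostOneMove (run (suc k))
      invariant ≤′-refl _ = inj₁ refl
      invariant {suc k} (≤′-step i≤′k) sk≤j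
        with invariant i≤′k (≤-trans (n≤1+n k) sk≤j) | stepView (suc k) (run (suc k))
      ... | inv | stay e = subst AtMostOneMove (sym e) inv
      ... | inj₁ t≡ | move x _ _ longest e =
        subst AtMostOneMove (sym e)
          (inj₂ (cong suc t≡ , x , refl , longest y (y∈ (≤′⇒≤ (≤′-step i≤′k)) sk≤j , y∈S)))
      ... | inj₂ (_ , x , cur , y≤x) | move _ dead _ _ _ =
        ⊥-elim (dead (subst (Alive (suc k)) (sym cur) x∈sk))
        where
        x∈k : InBag x k
        x∈k = subst (Alive k) cur
                (alive-after-step k (run k) (y∈ (≤′⇒≤ i≤′k) (≤-trans (n≤1+n k) sk≤j) , y∈S))
        x∈sk : InBag x (suc k)
        x∈sk = inBag-until-last x∈k (n≤1+n k) (≤-trans sk≤j (≤-trans (last-ub y∈j) y≤x))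

    lifetime-moves-sym : ∀ {y i j} → y ∈ S → InBag y i → InBag y j →
                         count (suc i) ≤ suc (count (suc j))
    lifetime-moves-sym {i = i} {j} y∈S y∈i y∈j with ≤-total i j
    ... | inj₁ i≤j = ≤-trans (count-mono (s≤s i≤j)) (n≤1+n _)
    ... | inj₂ j≤i = lifetime-moves y∈S y∈j y∈i j≤i

    walk-count-bound : ∀ f p → IsWalk G f p → (∀ k → f k ∈ S) → ∀ {s} → Selected (f 0) s →
                       ∀ k → k ≤ p → ∀ {i} → InBag (f k) i → count (suc i) ≤ count (suc s) + k
    walk-count-bound f p walk inS {s} sel zero _ f₀∈i =
      subst (_ ≤_) (sym (+-identityʳ _)) (selected-count-max sel f₀∈i)
    walk-count-bound f p walk inS {s} sel (suc k) sk≤p {i} f₁∈i with edgeBag (walk k sk≤p)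
    ... | e , fk∈e , fsk∈e = begin
      count (suc i)                  ≤⟨ lifetime-moves-sym (inS (suc k)) f₁∈i fsk∈e ⟩
      suc (count (suc e))            ≤⟨ s≤s (walk-count-bound f p walk inS sel k (<⇒≤ sk≤p) fk∈e) ⟩
      suc (count (suc s) + k)        ≡⟨ sym (+-suc _ k) ⟩
      count (suc s) + suc k          ∎
      where open ≤-Reasoning

    close-selections-coincide : ∀ ℓ f p → IsWalk G f p → (∀ k → f k ∈ S) → p ≤ ℓ →
                                ∀ {su sv} → Selected (f 0) su → Selected (f p) sv →
                                count (suc su) % suc ℓ ≡ count (suc sv) % suc ℓ → f 0 ≡ f p
    close-selections-coincide ℓ f p walk inS p≤ℓ {su} {sv} selu selv same-residue =
      just-injective (begin
        just (f 0)      ≡⟨ sym (proj₂ selu) ⟩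
        current (suc su) ≡⟨ cong proj₁ (count-determines-state (suc su) (suc sv) same-count) ⟩
        current (suc sv) ≡⟨ proj₂ selv ⟩
        just (f p)      ∎)
      where
      open ≡-Reasoning
      g : ℕ → V
      g k = f (p ∸ k)
      selu' : Selected (g p) su
      selu' = subst (λ j → Selected (f j) su) (sym (n∸n≡0 p)) selu
      forward : count (suc sv) ≤ count (suc su) + p
      forward = walk-count-bound f p walk inS selu p ≤-refl (proj₁ selv)
      backward : count (suc su) ≤ count (suc sv) + p
      backward = walk-count-bound g p (reverse-walk {G} f p walk) (λ k → inS (p ∸ k)) selv p ≤-refl
                   (proj₁ selu')
      same-count : count (suc su) ≡ count (suc sv)
      same-count = residue-close _ _ (suc ℓ) p same-residue forward backward (s≤s p≤ℓ)

    IsSelected : V → Set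
    IsSelected x = Σ ℕ (Selected x)

    selected? : ∀ x s → Dec (Selected x s)
    selected? x s with inBag? x s | ≡-dec _≟ᶠ_ (current (suc s)) (just x)
    ... | yes x∈s | yes cur = yes (x∈s , cur)
    ... | no x∉s | _ = no λ (x∈s , _) → x∉s x∈s
    ... | yes _ | no ¬cur = no λ (_ , cur) → ¬cur cur

    -- Selections happen at bag positions below M, so being selected is decidable.
    isSelected? : ∀ x → Dec (IsSelected x)
    isSelected? x with any? (λ (b : Fin M) → selected? x (toℕ b))
    ... | yes (b , sel) = yes (toℕ b , sel)
    ... | no none = no λ (s , sel) →
            none (fromℕ< (proj₁ (proj₁ sel)) , subst (Selected x) (sym (toℕ-fromℕ< _)) sel)

    X : Subset (n G)
    X = tabulate (λ x → does (isSelected? x))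

    ∈X⁺ : ∀ {x} → IsSelected x → x ∈ X
    ∈X⁺ {x} sel = lookup⇒[]= x X (trans (lookup∘tabulate _ x) (dec-true (isSelected? x) sel))

    ∈X⁻ : ∀ {x} → x ∈ X → IsSelected x
    ∈X⁻ {x} x∈X with isSelected? x | trans (sym (lookup∘tabulate _ x)) ([]=⇒lookup x∈X)
    ... | yes sel | _ = sel
    ... | no _ | ()

    selection-thins : ∀ {w} → (∀ b → ∣ bag D b ∩ S ∣ ≤ suc (suc w)) →
                      ∀ b → ∣ bag D b ∩ (S ─ X) ∣ ≤ suc w
    selection-thins wide b = remove-hitting-set (bag D b) S X hits (wide b)
      where
      hits : ∀ {y} → y ∈ bag D b ∩ S → Nonempty ((bag D b ∩ S) ∩ X)
      hits y∈ with x∈p∩q⁻ (bag D b) S y∈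
      ... | y∈b , y∈S with bag-has-selected (toInBag b y∈b , y∈S)
      ...   | x , sel , x∈S =
        x , x∈p∩q⁺ (x∈p∩q⁺ (fromInBag b (proj₁ sel) , x∈S) , ∈X⁺ (toℕ b , sel))

    module Extend (ℓ w : ℕ) (φ : V → ℕ) (φ-colours : ColoursIn {G} ((ℓ + 1) * w + 1) φ)
                  (φ-ranks : RankingOn ℓ G (S ─ X) φ) where
      base : ℕ
      base = (ℓ + 1) * w + 1

      colour : V → ℕ
      colour x with isSelected? x
      ... | yes (s , _) = base + suc (count (suc s) % suc ℓ)
      ... | no _ = φ x

      colour-selected : ∀ {x s} → Selected x s → colour x ≡ base + suc (count (suc s) % suc ℓ)
      colour-selected {x} {s} sel with isSelected? x
      ... | yes (s' , sel') = cong (λ t → base + suc (t % suc ℓ)) (selected-count-unique sel' sel)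
      ... | no unsel = ⊥-elim (unsel (s , sel))

      colour-unselected : ∀ {x} → ¬ IsSelected x → colour x ≡ φ x
      colour-unselected {x} unsel with isSelected? x
      ... | yes sel = ⊥-elim (unsel sel)
      ... | no _ = refl

      unselected-below-base : ∀ {x} → ¬ IsSelected x → colour x ≤ base
      unselected-below-base {x} unsel =
        subst (_≤ base) (sym (colour-unselected unsel)) (proj₂ (φ-colours x))

      selected-above-base : ∀ {x s} → Selected x s → base < colour x
      selected-above-base sel = subst (base <_) (sym (colour-selected sel)) (m<m+n base z<s)

      more-colours : base + suc ℓ ≡ (ℓ + 1) * suc w + 1
      more-colours = solve 2 (λ l v → ((l :+ con 1) :* v :+ con 1) :+ (con 1 :+ l)
                                 := (l :+ con 1) :* (con 1 :+ v) :+ con 1) refl ℓ w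
        where open +-*-Solver

      colours : ColoursIn {G} ((ℓ + 1) * suc w + 1) colour
      colours x with isSelected? x
      ... | yes (s , _) =
        ≤-trans (s≤s z≤n) (m<m+n base z<s) ,
        ≤-trans (+-monoʳ-≤ base (m%n<n (count (suc s)) (suc ℓ))) (≤-reflexive more-colours)
      ... | no _ =
        proj₁ (φ-colours x) ,
        ≤-trans (proj₂ (φ-colours x)) (subst (base ≤_) more-colours (m≤m+n base (suc ℓ)))

      selected-ends-differ : ∀ {p} (P : GPath G p) → 1 ≤ p → p ≤ ℓ → (∀ k → vtx P k ∈ S) →
                             ∀ {su sv} → Selected (vtx P fzero) su → Selected (vtx P (fromℕ p)) sv →
                             colour (vtx P fzero) ≢ colour (vtx P (fromℕ p))
      selected-ends-differ {p} P 1≤p p≤ℓ inS {su} {sv} selu selv same =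
        path-ends-distinct P 1≤p (trans (sym (walkOf-start P)) (trans walk-ends (walkOf-end P)))
        where
        same-residue : count (suc su) % suc ℓ ≡ count (suc sv) % suc ℓ
        same-residue = suc-injective (+-cancelˡ-≡ base _ _
          (trans (sym (colour-selected selu)) (trans same (colour-selected selv))))
        walk-ends : walkOf P 0 ≡ walkOf P p
        walk-ends = close-selections-coincide ℓ (walkOf P) p (walkOf-isWalk P)
          (λ k → inS (position p k)) p≤ℓ
          (subst (λ x → Selected x su) (sym (walkOf-start P)) selu)
          (subst (λ x → Selected x sv) (sym (walkOf-end P)) selv) same-residue

      -- Ends selected: distinct fresh colours.  Exactly one end selected: it is above base,
      -- the other not.  Neither: a selected inner vertex exceeds both, or else the path
      -- avoids X and φ already ranks it.
      ranks : RankingOn ℓ G S colour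
      ranks p 1≤p p≤ℓ P inS
        with toSum (isSelected? (vtx P fzero)) | toSum (isSelected? (vtx P (fromℕ p)))
      ... | inj₁ (_ , selu) | inj₁ (_ , selv) = inj₁ (selected-ends-differ P 1≤p p≤ℓ inS selu selv)
      ... | inj₁ (_ , selu) | inj₂ unselv = inj₁ λ same →
        <⇒≱ (selected-above-base selu) (subst (_≤ base) (sym same) (unselected-below-base unselv))
      ... | inj₂ unselu | inj₁ (_ , selv) = inj₁ λ same →
        <⇒≱ (selected-above-base selv) (subst (_≤ base) same (unselected-below-base unselu))
      ... | inj₂ unselu | inj₂ _ with any? (λ k → isSelected? (vtx P k))
      ...   | yes (k , (_ , selk)) = inj₂ (<-≤-trans
              (≤-<-trans (unselected-below-base unselu) (selected-above-base selk))
              (maxF-ub (suc p) (λ i → colour (vtx P i)) k))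
      ...   | no none = ranking-transfer P φ colour
              (λ k → sym (colour-unselected (λ sel → none (k , sel))))
              (φ-ranks p 1≤p p≤ℓ P (λ k → x∈p∧x∉q⇒x∈p─q (inS k) (λ k∈X → none (k , ∈X⁻ k∈X))))

  thin-set-independent : ∀ {S} → (∀ b → ∣ bag D b ∩ S ∣ ≤ 1) →
                         ∀ {u v} → u ∈ S → v ∈ S → ¬ Adj G u v
  thin-set-independent {S} thin u∈S v∈S uv with edges D _ _ uv
  ... | b , u∈b , v∈b = <-irrefl refl (≤-trans two-in-bag (thin b))
    where
    two-in-bag : 2 ≤ ∣ bag D b ∩ S ∣
    two-in-bag = distinct-members (bag D b ∩ S) (x∈p∩q⁺ (u∈b , u∈S)) (x∈p∩q⁺ (v∈b , v∈S))
                   λ { refl → irrefl G uv }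

  rankingOn : ∀ ℓ w (S : Subset (n G)) → (∀ b → ∣ bag D b ∩ S ∣ ≤ suc w) →
              Σ (V → ℕ) λ φ → ColoursIn {G} ((ℓ + 1) * w + 1) φ × RankingOn ℓ G S φ
  rankingOn ℓ zero S thin = (λ _ → 1) , (λ _ → ≤-refl , m≤n+m 1 _) , no-paths
    where
    no-paths : RankingOn ℓ G S (λ _ → 1)
    no-paths (suc p) _ _ P inS =
      ⊥-elim (thin-set-independent thin (inS fzero) (inS (fsuc fzero)) (adjacent P fzero))
  rankingOn ℓ (suc w) S thin = colour , colours , ranks
    where
    open Scan S
    rest : Σ (V → ℕ) λ φ → ColoursIn {G} ((ℓ + 1) * w + 1) φ × RankingOn ℓ G (S ─ X) φ
    rest = rankingOn ℓ w (S ─ X) (selection-thins thin)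
    open Extend ℓ w (proj₁ rest) (proj₁ (proj₂ rest)) (proj₂ (proj₂ rest))

lemma24 : ∀ (ℓ : ℕ) → 1 ≤ ℓ → (G : Graph) → (w : ℕ) → PathwidthAtMost G w →
          HasRankingWith ℓ G ((ℓ + 1) * w + 1)
lemma24 ℓ _ G w (D , narrow) with Ranking.rankingOn G D ℓ w ⊤ all-vertices-thin
  where
  all-vertices-thin : ∀ b → ∣ bag D b ∩ ⊤ ∣ ≤ suc w
  all-vertices-thin b = ≤-trans (∣p∩q∣≤∣p∣ (bag D b) ⊤) (narrow b)
... | φ , colours , ranks = φ , colours , λ p 1≤p p≤ℓ P → ranks p 1≤p p≤ℓ P (λ _ → ∈⊤)
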